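{- Let $n$ be an even positive integer. The digraph $\vec{C}_n \wr K^*_2$ is not hamiltonian decomposable.
   Context: $\vec{C}_n$ is the directed $n$-cycle and $K^*_2$ is the complete symmetric digraph on two vertices (two vertices with both arcs between them). A digraph is hamiltonian decomposable if its arc set can be partitioned into directed hamiltonian cycles. The wreath product $G \wr H$ has vertex set $V(G)\times V(H)$, with $((g_1,h_1),(g_2,h_2))$ an arc iff $(g_1,g_2)\in A(G)$, or $g_1=g_2$ and $(h_1,h_2)\in A(H)$. -}

module Defs where

open import Data.Nat using (ℕ; suc)
open import Data.Fin using (Fin; toℕ)
open import Data.Product using (_×_; Σ; ∃; ∃-syntax)
open import Data.Sum using (_⊎_)
open import Relation.Binary.PropositionalEquality using (_≡_; _≢_)
open import Function.Definitions using (Bijective)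

record Digraph : Set₁ where
  field
    Vertex : Set
    Arc    : Vertex → Vertex → Set
open Digraph public

CycSucc : (N : ℕ) → Fin N → Fin N → Set
CycSucc N i j = (suc (toℕ i) ≡ toℕ j) ⊎ ((suc (toℕ i) ≡ N) × (toℕ j ≡ 0))

DiCycle : ℕ → Digraph
DiCycle n = record { Vertex = Fin n ; Arc = CycSucc n }

K2* : Digraph
K2* = record { Vertex = Fin 2 ; Arc = λ i j → i ≢ j }

_≀_ : Digraph → Digraph → Digraph
G ≀ H = record
  { Vertex = Vertex G × Vertex H
  ; Arc    = λ { (g₁ , h₁) (g₂ , h₂) →
                 Arc G g₁ g₂ ⊎ ((g₁ ≡ g₂) × Arc H h₁ h₂) } }
  where open import Data.Product using (_,_)

record HamCycle (G : Digraph) : Set where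
  field
    len    : ℕ
    order  : Fin len → Vertex G
    bij    : Bijective _≡_ _≡_ order
    arcs   : ∀ k k' → CycSucc len k k' → Arc G (order k) (order k')
open HamCycle public

InCycle : {G : Digraph} → HamCycle G → Vertex G → Vertex G → Set
InCycle C u v = ∃[ k ] ∃[ k' ] (CycSucc (len C) k k' × (order C k ≡ u) × (order C k' ≡ v))

-- Hamiltonian decomposable: the arc set is partitioned by finitely many
-- hamiltonian cycles (every arc lies in exactly one of them; arcs of the
-- cycles are arcs of G by definition of HamCycle).
HamDecomposable : Digraph → Set
HamDecomposable G =
  Σ ℕ λ m → Σ (Fin m → HamCycle G) λ H →
    ∀ u v → Arc G u v →
      ∃[ i ] (InCycle (H i) u v × (∀ j → InCycle (H j) u v → j ≡ i))

-- Call the arcs (i , b) → (i , other b) inside a column vertical. A cycle without vertical arcs in column i maps column i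
-- bijectively onto column i + 1, so it has none in column i + 1 either; hence Z is purely
-- horizontal. Along every arc u → w of Z, the cycle through the vertical arc leaving u also
-- carries the vertical arc leaving w. So one cycle carries both vertical arcs of column 0, i.e.
-- a 2-cycle, which a hamiltonian cycle through 2n ≥ 4 vertices cannot contain.
module Submission where

open import Defs
open import Data.Nat using (ℕ; _<_)
open import Data.Nat.Divisibility using (_∣_)
open import Relation.Nullary using (¬_)

open import Data.Nat using (zero; suc; _+_; _*_; _≤_; s≤s)
open import Data.Nat.Properties
  using (≤-reflexive; ≤-trans; m≤n⇒m≤1+n; <-irrefl; suc-injective; m≢1+n+m)
open import Data.Nat.Divisibility using (divides)
open import Data.Fin using (Fin; zero; suc; toℕ; fromℕ; inject₁; combine; remQuot; _≟_)
open import Data.Fin.Properties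
  using (toℕ-injective; toℕ<n; toℕ-fromℕ; toℕ-inject₁; ≤fromℕ; combine-remQuot; injective⇒≤)
open import Data.Fin.Induction using (<-weakInduction; <-weakInduction-startingFrom)
open import Data.Fin.Relation.Unary.Top using (view; ‵fromℕ; ‵inject₁)
open import Data.Product using (_×_; ∃-syntax; _,_; proj₁; proj₂; uncurry)
open import Data.Sum using (_⊎_; inj₁; inj₂)
open import Data.Empty using (⊥; ⊥-elim)
open import Function.Definitions using (Injective)
open import Level using (Level)
open import Relation.Nullary using (Dec; yes; no)
open import Relation.Binary.PropositionalEquality

private
  variable
    ℓ : Level
    m N : ℕ
    i i' j j' : Fin N

CycSucc-functional : CycSucc N i j → CycSucc N i j' → j ≡ j'
CycSucc-functional (inj₁ p) (inj₁ q) = toℕ-injective (trans (sym p) q)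
CycSucc-functional (inj₂ (_ , p)) (inj₂ (_ , q)) = toℕ-injective (trans p (sym q))
CycSucc-functional {j = j} (inj₁ p) (inj₂ (q , _)) =
  ⊥-elim (<-irrefl (trans (sym p) q) (toℕ<n j))
CycSucc-functional {j' = j'} (inj₂ (q , _)) (inj₁ p) =
  ⊥-elim (<-irrefl (trans (sym p) q) (toℕ<n j'))

CycSucc-injective : CycSucc N i j → CycSucc N i' j → i ≡ i'
CycSucc-injective (inj₁ p) (inj₁ q) = toℕ-injective (suc-injective (trans p (sym q)))
CycSucc-injective (inj₂ (p , _)) (inj₂ (q , _)) = toℕ-injective (suc-injective (trans p (sym q)))
CycSucc-injective (inj₁ p) (inj₂ (_ , q)) with () ← trans p q
CycSucc-injective (inj₂ (_ , q)) (inj₁ p) with () ← trans p q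

CycSucc⇒≢ : CycSucc (2 + m) i j → i ≢ j
CycSucc⇒≢ {i = i} (inj₁ p) refl = m≢1+n+m (toℕ i) (sym p)
CycSucc⇒≢ (inj₂ (p , q)) refl with () ← trans (sym p) (cong suc q)

CycSucc-2-cycle⇒N≤2 : CycSucc N i j → CycSucc N j i → N ≤ 2
CycSucc-2-cycle⇒N≤2 {i = i} (inj₁ p) (inj₁ q) =
  ⊥-elim (m≢1+n+m (toℕ i) (sym (trans (cong suc p) q)))
CycSucc-2-cycle⇒N≤2 (inj₁ p) (inj₂ (q , r)) =
  ≤-reflexive (trans (sym q) (cong suc (trans (sym p) (cong suc r))))
CycSucc-2-cycle⇒N≤2 (inj₂ (p , q)) (inj₁ r) =
  ≤-reflexive (trans (sym p) (cong suc (trans (sym r) (cong suc q))))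
CycSucc-2-cycle⇒N≤2 (inj₂ (_ , q)) (inj₂ (r , _)) =
  m≤n⇒m≤1+n (≤-reflexive (trans (sym r) (cong suc q)))

inject₁-CycSucc-suc : (i : Fin N) → CycSucc (suc N) (inject₁ i) (suc i)
inject₁-CycSucc-suc i = inj₁ (cong suc (toℕ-inject₁ i))

fromℕ-CycSucc-zero : ∀ N → CycSucc (suc N) (fromℕ N) zero
fromℕ-CycSucc-zero N = inj₂ (cong suc (toℕ-fromℕ N) , refl)

CycSucc-successor : (i : Fin N) → ∃[ j ] CycSucc N i j
CycSucc-successor {suc N} i with view i
... | ‵fromℕ = zero , fromℕ-CycSucc-zero N
... | ‵inject₁ i = suc i , inject₁-CycSucc-suc i

CycSucc-predecessor : (j : Fin N) → ∃[ i ] CycSucc N i j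
CycSucc-predecessor {suc N} zero = fromℕ N , fromℕ-CycSucc-zero N
CycSucc-predecessor (suc j) = inject₁ j , inject₁-CycSucc-suc j

CycSucc-transport : (P : Fin N → Set ℓ) → (∀ {i j} → CycSucc N i j → P i → P j) →
                    P i → P j
CycSucc-transport {N = suc N} {i = i} {j = j} P step Pi =
  <-weakInduction P (step (fromℕ-CycSucc-zero N) P-last) (λ k → step (inject₁-CycSucc-suc k)) j
  where
  P-last : P (fromℕ N)
  P-last = <-weakInduction-startingFrom P Pi (λ k → step (inject₁-CycSucc-suc k)) (≤fromℕ i)

module HamCycleProperties {G : Digraph} (C : HamCycle G) where

  private
    order-injective : Injective _≡_ _≡_ (order C)
    order-injective = proj₁ (bij C)

    position : Vertex G → Fin (len C)
    position v = proj₁ (proj₂ (bij C) v)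

    order-position : ∀ v → order C (position v) ≡ v
    order-position v = proj₂ (proj₂ (bij C) v) refl

    variable
      u u' w w' : Vertex G

  InCycle-functional : InCycle C u w → InCycle C u w' → w ≡ w'
  InCycle-functional (_ , _ , s , refl , refl) (_ , _ , s' , p , refl)
    with refl ← order-injective p = cong (order C) (CycSucc-functional s s')

  InCycle-injective : InCycle C u w → InCycle C u' w → u ≡ u'
  InCycle-injective (_ , _ , s , refl , refl) (_ , _ , s' , refl , p)
    with refl ← order-injective p = cong (order C) (CycSucc-injective s s')

  InCycle-successor : ∀ u → ∃[ w ] InCycle C u w
  InCycle-successor u with CycSucc-successor (position u)
  ... | k' , s = order C k' , position u , k' , s , order-position u , refl

  InCycle-predecessor : ∀ w → ∃[ u ] InCycle C u w
  InCycle-predecessor w with CycSucc-predecessor (position w)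
  ... | k , s = order C k , k , position w , s , refl , order-position w

  InCycle⇒Arc : InCycle C u w → Arc G u w
  InCycle⇒Arc (k , k' , s , refl , refl) = arcs C k k' s

  InCycle-2-cycle⇒len≤2 : InCycle C u w → InCycle C w u → len C ≤ 2
  InCycle-2-cycle⇒len≤2 (_ , _ , s , refl , refl) (_ , _ , s' , p , q)
    with refl ← order-injective p | refl ← order-injective q = CycSucc-2-cycle⇒N≤2 s s'

  injective⇒≤len : (f : Fin m → Vertex G) → Injective _≡_ _≡_ f → m ≤ len C
  injective⇒≤len f f-injective = injective⇒≤ {f = λ x → position (f x)} λ {x} {y} p →
    f-injective (begin
      f x                      ≡⟨ order-position (f x) ⟨
      order C (position (f x)) ≡⟨ cong (order C) p ⟩
      order C (position (f y)) ≡⟨ order-position (f y) ⟩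
      f y                      ∎)
    where open ≡-Reasoning

  InCycle-invariant : {A : Set ℓ} (f : Vertex G → A) → (∀ {u w} → InCycle C u w → f u ≡ f w) →
                      ∀ u v → f u ≡ f v
  InCycle-invariant f step u v =
    trans (sym (along (cong f (order-position u)))) (cong f (order-position v))
    where
    along : f (order C (position u)) ≡ f u → f (order C (position v)) ≡ f u
    along = CycSucc-transport (λ k → f (order C k) ≡ f u)
              (λ s p → trans (sym (step (_ , _ , s , refl , refl))) p)

other : Fin 2 → Fin 2
other zero = suc zero
other (suc zero) = zero

other-≢ : ∀ b → b ≢ other b
other-≢ zero ()
other-≢ (suc zero) ()

other-involutive : ∀ b → other (other b) ≡ b
other-involutive zero = refl
other-involutive (suc zero) = refl

≢⇒≡other : ∀ {c b : Fin 2} → c ≢ b → c ≡ other b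
≢⇒≡other {zero} {zero} c≢b = ⊥-elim (c≢b refl)
≢⇒≡other {zero} {suc zero} _ = refl
≢⇒≡other {suc zero} {zero} _ = refl
≢⇒≡other {suc zero} {suc zero} c≢b = ⊥-elim (c≢b refl)

wreath-arc-cases : ∀ {b b'} → Arc (DiCycle N ≀ K2*) (i , b) (i' , b') →
                   CycSucc N i i' ⊎ (i ≡ i' × b' ≡ other b)
wreath-arc-cases (inj₁ s) = inj₁ s
wreath-arc-cases (inj₂ (p , b≢b')) = inj₂ (p , ≢⇒≡other (≢-sym b≢b'))

vertical : ∀ (i : Fin N) b → Arc (DiCycle N ≀ K2*) (i , b) (i , other b)
vertical i b = inj₂ (refl , other-≢ b)

remQuot-injective : ∀ k → Injective _≡_ _≡_ (remQuot {N} k)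
remQuot-injective {N} k {x} {y} p = begin
  x                                 ≡⟨ combine-remQuot {N} k x ⟨
  uncurry combine (remQuot {N} k x) ≡⟨ cong (uncurry combine) p ⟩
  uncurry combine (remQuot {N} k y) ≡⟨ combine-remQuot {N} k y ⟩
  y                                 ∎
  where open ≡-Reasoning

wreath-len : (C : HamCycle (DiCycle N ≀ K2*)) → N * 2 ≤ len C
wreath-len C = HamCycleProperties.injective⇒≤len C (remQuot 2) (remQuot-injective 2)

module Decomposition {G : Digraph} (D : HamDecomposable G) where

  M : ℕ
  M = proj₁ D

  cycle : Fin M → HamCycle G
  cycle = proj₁ (proj₂ D)

  infix 4 _∋_⟶_
  _∋_⟶_ : Fin M → Vertex G → Vertex G → Set
  c ∋ u ⟶ w = InCycle (cycle c) u w

  module _ (c : Fin M) where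
    open HamCycleProperties (cycle c) public

  cycleOf : ∀ {u w} → Arc G u w → Fin M
  cycleOf {u} {w} a = proj₁ (proj₂ (proj₂ D) u w a)

  cycleOf-∋ : ∀ {u w} (a : Arc G u w) → cycleOf a ∋ u ⟶ w
  cycleOf-∋ {u} {w} a = proj₁ (proj₂ (proj₂ (proj₂ D) u w a))

  ∋-unique : ∀ {c c' u w} → c ∋ u ⟶ w → c' ∋ u ⟶ w → c ≡ c'
  ∋-unique {c} {c'} {u} {w} r r' =
    trans (unique c r) (sym (unique c' r'))
    where unique = proj₂ (proj₂ (proj₂ (proj₂ D) u w (InCycle⇒Arc c r)))

module DiCycle≀K2* (m : ℕ) (D : HamDecomposable (DiCycle (2 + m) ≀ K2*)) where

  open Decomposition D

  private
    G : Digraph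
    G = DiCycle (2 + m) ≀ K2*

    variable
      Z c : Fin M
      b b' : Fin 2
      u w : Fin (2 + m) × Fin 2

  no-2-cycle : c ∋ u ⟶ w → ¬ c ∋ w ⟶ u
  no-2-cycle {c} r r'
    with s≤s (s≤s ()) ← ≤-trans (wreath-len (cycle c)) (InCycle-2-cycle⇒len≤2 c r r')

  NoVerticalAt : Fin M → Fin (2 + m) → Set
  NoVerticalAt Z i = ∀ b → ¬ Z ∋ (i , b) ⟶ (i , other b)

  Horizontal : Fin M → Set
  Horizontal Z = ∀ i → NoVerticalAt Z i

  verticalCycle : Fin (2 + m) × Fin 2 → Fin M
  verticalCycle (i , b) = cycleOf (vertical i b)

  verticalCycle-∋ : ∀ i b → verticalCycle (i , b) ∋ (i , b) ⟶ (i , other b)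
  verticalCycle-∋ i b = cycleOf-∋ (vertical i b)

  noVertical⇒CycSucc : NoVerticalAt Z i → Z ∋ (i , b) ⟶ (i' , b') → CycSucc (2 + m) i i'
  noVertical⇒CycSucc {Z} {b = b} nv r with wreath-arc-cases (InCycle⇒Arc Z r)
  ... | inj₁ s = s
  ... | inj₂ (refl , refl) = ⊥-elim (nv b r)

  vertical-then-CycSucc : c ∋ (i , b) ⟶ (i , other b) → c ∋ (i , other b) ⟶ (i' , b') →
                          CycSucc (2 + m) i i'
  vertical-then-CycSucc {c} {i} {b} v r with wreath-arc-cases (InCycle⇒Arc c r)
  ... | inj₁ s = s
  ... | inj₂ (refl , refl) =
    ⊥-elim (no-2-cycle v (subst (λ x → c ∋ (i , other b) ⟶ (i , x)) (other-involutive b) r))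

  CycSucc-then-vertical : c ∋ (i , b) ⟶ (i' , b') → c ∋ (i' , b') ⟶ (i' , other b') →
                          CycSucc (2 + m) i i'
  CycSucc-then-vertical {c} {i} {b} r v with wreath-arc-cases (InCycle⇒Arc c r)
  ... | inj₁ s = s
  ... | inj₂ (refl , refl) =
    ⊥-elim (no-2-cycle r (subst (λ x → c ∋ (i , other b) ⟶ (i , x)) (other-involutive b) v))

  noVertical⇒column-covered : NoVerticalAt Z i → CycSucc (2 + m) i i' →
                              ∀ d → ∃[ e ] Z ∋ (i , e) ⟶ (i' , d)
  noVertical⇒column-covered {Z} {i} nv s d
    with InCycle-successor Z (i , zero) | InCycle-successor Z (i , suc zero)
  ... | (_ , c₀) , r₀ | (_ , c₁) , r₁
    with refl ← CycSucc-functional s (noVertical⇒CycSucc nv r₀)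
       | refl ← CycSucc-functional s (noVertical⇒CycSucc nv r₁)
    with d ≟ c₀
  ... | yes refl = zero , r₀
  ... | no d≢c₀ = suc zero , subst (λ x → Z ∋ (i , suc zero) ⟶ (_ , x)) c₁≡d r₁
    where
    c₁≢c₀ : c₁ ≢ c₀
    c₁≢c₀ refl with () ← InCycle-injective Z r₀ r₁
    c₁≡d : c₁ ≡ d
    c₁≡d = trans (≢⇒≡other c₁≢c₀) (sym (≢⇒≡other d≢c₀))

  noVerticalAt-step : CycSucc (2 + m) i i' → NoVerticalAt Z i → NoVerticalAt Z i'
  noVerticalAt-step {Z = Z} s nv b' r with noVertical⇒column-covered nv s (other b')
  ... | _ , r' = CycSucc⇒≢ s (cong proj₁ (InCycle-injective Z r' r))

  leaves-column⇒noVertical : Z ∋ (i , b) ⟶ (i' , b') → CycSucc (2 + m) i i' →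
                             Z ≢ verticalCycle (i , other b) → NoVerticalAt Z i
  leaves-column⇒noVertical {Z} {i} {b} r s Z≢Y b'' r'' with b'' ≟ b
  ... | yes refl = CycSucc⇒≢ s (sym (cong proj₁ (InCycle-functional Z r r'')))
  ... | no b''≢b with refl ← ≢⇒≡other b''≢b = Z≢Y (∋-unique r'' (verticalCycle-∋ i (other b)))

  noVerticalAt-exists : CycSucc (2 + m) i i' → ∃[ Z ] NoVerticalAt Z i
  noVerticalAt-exists {i} {i'} s = pick (W₀ ≟ Y)
    where
    a₀ : Arc G (i , zero) (i' , zero)
    a₀ = inj₁ s
    a₁ : Arc G (i , zero) (i' , suc zero)
    a₁ = inj₁ s
    W₀ W₁ Y : Fin M
    W₀ = cycleOf a₀
    W₁ = cycleOf a₁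
    Y = verticalCycle (i , suc zero)
    W₀≢W₁ : W₀ ≢ W₁
    W₀≢W₁ W₀≡W₁
      with () ← InCycle-functional W₀ (cycleOf-∋ a₀)
                  (subst (_∋ _ ⟶ _) (sym W₀≡W₁) (cycleOf-∋ a₁))
    pick : Dec (W₀ ≡ Y) → ∃[ Z ] NoVerticalAt Z i
    pick (no W₀≢Y) = W₀ , leaves-column⇒noVertical (cycleOf-∋ a₀) s W₀≢Y
    pick (yes W₀≡Y) =
      W₁ , leaves-column⇒noVertical (cycleOf-∋ a₁) s λ W₁≡Y → W₀≢W₁ (trans W₀≡Y (sym W₁≡Y))

  horizontal-exists : ∃[ Z ] Horizontal Z
  horizontal-exists with noVerticalAt-exists (proj₂ (CycSucc-successor zero))
  ... | Z , nv = Z , λ i → CycSucc-transport (NoVerticalAt Z) noVerticalAt-step nv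

  module _ (horizontal : Horizontal Z) where

    private
      arc-disjoint : c ∋ (i , b) ⟶ (i , other b) → c ∋ u ⟶ w → ¬ Z ∋ u ⟶ w
      arc-disjoint {b = b} v r r' with refl ← ∋-unique r r' = horizontal _ b v

      CycSucc-of : Z ∋ (i , b) ⟶ (i' , b') → CycSucc (2 + m) i i'
      CycSucc-of = noVertical⇒CycSucc (horizontal _)

    verticalCycle-continues : Z ∋ (i , b) ⟶ (i' , b') →
                              verticalCycle (i , b) ∋ (i , other b) ⟶ (i' , b')
    verticalCycle-continues {i} {b} {i'} {b'} r
      with InCycle-successor (verticalCycle (i , b)) (i , other b)
         | InCycle-successor Z (i , other b)
    ... | (_ , c) , rX | (_ , d) , rZ
      with refl ← CycSucc-functional (CycSucc-of r)
                    (vertical-then-CycSucc (verticalCycle-∋ i b) rX)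
         | refl ← CycSucc-functional (CycSucc-of r) (CycSucc-of rZ)
      = subst (λ x → verticalCycle (i , b) ∋ (i , other b) ⟶ (i' , x)) c≡b' rX
      where
      b'≢d : b' ≢ d
      b'≢d refl = other-≢ b (cong proj₂ (InCycle-injective Z r rZ))
      c≢d : c ≢ d
      c≢d refl = arc-disjoint (verticalCycle-∋ i b) rX rZ
      c≡b' : c ≡ b'
      c≡b' = trans (≢⇒≡other c≢d) (sym (≢⇒≡other b'≢d))

    verticalCycle-entered : Z ∋ (i , b) ⟶ (i' , b') →
                            verticalCycle (i' , b') ∋ (i , other b) ⟶ (i' , b')
    verticalCycle-entered {i} {b} {i'} {b'} r
      with InCycle-predecessor (verticalCycle (i' , b')) (i' , b')
    ... | (_ , e) , rX'
      with refl ← CycSucc-injective (CycSucc-of r)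
                    (CycSucc-then-vertical rX' (verticalCycle-∋ i' b'))
      = subst (λ x → verticalCycle (i' , b') ∋ (i , x) ⟶ (i' , b')) (≢⇒≡other e≢b) rX'
      where
      e≢b : e ≢ b
      e≢b refl = arc-disjoint (verticalCycle-∋ i' b') rX' r

    verticalCycle-invariant : Z ∋ u ⟶ w → verticalCycle u ≡ verticalCycle w
    verticalCycle-invariant r =
      ∋-unique (verticalCycle-continues r) (verticalCycle-entered r)

  impossible : ⊥
  impossible with horizontal-exists
  ... | Z , horizontal = no-2-cycle (verticalCycle-∋ zero zero) back
    where
    same : verticalCycle (zero , zero) ≡ verticalCycle (zero , suc zero)
    same = InCycle-invariant Z verticalCycle (verticalCycle-invariant horizontal) _ _
    back : verticalCycle (zero , zero) ∋ (zero , suc zero) ⟶ (zero , zero)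
    back = subst (_∋ _ ⟶ _) (sym same) (verticalCycle-∋ zero (suc zero))

-- Evenness only excludes n = 1; the argument works for every n ≥ 2.
proposition4p1 : (n : ℕ) → 0 < n → 2 ∣ n → ¬ HamDecomposable (DiCycle n ≀ K2*)
proposition4p1 zero () _
proposition4p1 (suc zero) _ (divides zero ())
proposition4p1 (suc zero) _ (divides (suc _) ())
proposition4p1 (suc (suc m)) _ _ D = DiCycle≀K2*.impossible m D
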